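{- Let $G=(L,R,E)$ be a bipartite graph on $n$ vertices with maximum left degree $\Delta_L(G)\le 4\rho^*(G)$. For any number of arrivals $T$, with high probability all left vertices have degree $O(\mathrm{OPT}(G,T)+\log n)$ in the sampled graph $G'_T$.
   Context: $G'_T$ is the multigraph formed by $T$ edges drawn independently and uniformly from $E$ (with replacement); $\mathrm{OPT}(G,T)$ is the expectation of the minimum, over orientations of the edges of $G'_T$, of the maximum in-degree. $\rho^*(G)=\max_{\emptyset\ne S\subseteq V}|E(G[S])|/|S|$. $\Delta_L(G)$ is the maximum degree of a vertex in $L$. "With high probability" means with probability $1-1/\mathrm{poly}(n)$. -}

module Defs where

open import Data.Nat using (ℕ; zero; suc; _+_; _*_; _^_; _≤_; _<_; _⊔_; _⊓_; _<?_)
open import Data.Nat.Logarithm using (⌈log₂_⌉)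
open import Data.Nat.ListAction using (sum)
open import Data.Fin using (Fin; _↑ˡ_; _↑ʳ_)
open import Data.Fin.Properties using (_≟_)
open import Data.Fin.Subset using (Subset; Nonempty; ∣_∣)
open import Data.Fin.Subset.Properties using (_∈?_)
open import Data.List using (List; []; _∷_; length; filterᵇ; map; foldr; concatMap; allFin; lookup; zip; [_])
open import Data.Vec as V using (Vec)
open import Data.Bool using (Bool; true; false; _∧_; _∨_; if_then_else_)
open import Data.Product using (_×_; _,_; proj₁; proj₂; Σ; ∃-syntax)
open import Relation.Nullary.Decidable using (⌊_⌋)
open import Data.List.Relation.Unary.Unique.Propositional using (Unique)

count : {A : Set} → (A → Bool) → List A → ℕ
count p xs = length (filterᵇ p xs)

record BipGraph : Set where
  field
    a     : ℕ
    b     : ℕ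
    edges : List (Fin a × Fin b)
open BipGraph public

nV : BipGraph → ℕ
nV G = a G + b G

nE : BipGraph → ℕ
nE G = length (edges G)

Simple : BipGraph → Set
Simple G = Unique (edges G)

degL : {a b : ℕ} → List (Fin a × Fin b) → Fin a → ℕ
degL es u = count (λ e → ⌊ proj₁ e ≟ u ⌋) es

ΔL : BipGraph → ℕ
ΔL G = foldr _⊔_ 0 (map (degL (edges G)) (allFin (a G)))

-- Vertex set V = L ⊎ R identified with Fin (a + b): left u ↦ u ↑ˡ b, right v ↦ a ↑ʳ v.
-- |E(G[S])| for S ⊆ V
edgesIn : (G : BipGraph) → Subset (nV G) → ℕ
edgesIn G S = count (λ e → ⌊ (proj₁ e ↑ˡ b G) ∈? S ⌋ ∧ ⌊ (a G ↑ʳ proj₂ e) ∈? S ⌋) (edges G)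

-- Δ_L(G) ≤ 4 ρ*(G), where ρ*(G) = max_{∅≠S⊆V} |E(G[S])|/|S|.
-- Unfolded: Δ_L ≤ 4 · max_S (e(S)/|S|)  iff  some nonempty S has Δ_L · |S| ≤ 4 · e(S).
ΔL≤4ρ* : BipGraph → Set
ΔL≤4ρ* G = ∃[ S ] (Nonempty S × ΔL G * ∣ S ∣ ≤ 4 * edgesIn G S)

-- All sequences of T draws from Fin m (the uniform sample space of T draws with replacement).
allSeqs : (T m : ℕ) → List (Vec (Fin m) T)
allSeqs zero    m = [ V.[] ]
allSeqs (suc T) m = concatMap (λ i → map (i V.∷_) (allSeqs T m)) (allFin m)

-- The multigraph G'_T determined by a draw sequence s (list of sampled edges).
sampled : (G : BipGraph) {T : ℕ} → Vec (Fin (nE G)) T → List (Fin (a G) × Fin (b G))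
sampled G s = V.toList (V.map (lookup (edges G)) s)

-- All boolean lists of length k (orientations of k edges).
allBools : ℕ → List (List Bool)
allBools zero    = [ [] ]
allBools (suc k) = concatMap (λ x → map (x ∷_) (allBools k)) (true ∷ false ∷ [])

minL : List ℕ → ℕ
minL []       = 0
minL (x ∷ xs) = foldr _⊓_ x xs

-- Orientation bit true: edge (u,v) points into u (left); false: into v (right).
inDegL : {a b : ℕ} → List ((Fin a × Fin b) × Bool) → Fin a → ℕ
inDegL oes u = count (λ p → ⌊ proj₁ (proj₁ p) ≟ u ⌋ ∧ proj₂ p) oes

inDegR : {a b : ℕ} → List ((Fin a × Fin b) × Bool) → Fin b → ℕ
inDegR oes v = count (λ p → ⌊ proj₂ (proj₁ p) ≟ v ⌋ ∧ (if proj₂ p then false else true)) oes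

maxInDeg : {a b : ℕ} → List ((Fin a × Fin b) × Bool) → ℕ
maxInDeg {a} {b} oes =
  foldr _⊔_ 0 (map (inDegL oes) (allFin a)) ⊔ foldr _⊔_ 0 (map (inDegR oes) (allFin b))

minMaxInDeg : {a b : ℕ} → List (Fin a × Fin b) → ℕ
minMaxInDeg es = minL (map (λ o → maxInDeg (zip es o)) (allBools (length es)))

-- OPT(G,T) = optNum G T / |E|^T  (expectation over the uniform sample space);
-- the denominator is the size of the sample space, length (allSeqs T (nE G)) = |E|^T.
optNum : BipGraph → ℕ → ℕ
optNum G T = sum (map (λ s → minMaxInDeg (sampled G s)) (allSeqs T (nE G)))

sampleSize : BipGraph → ℕ → ℕ
sampleSize G T = length (allSeqs T (nE G))

-- Bad event: some left vertex u has degree in G'_T exceeding C·(OPT(G,T) + ⌈log₂ n⌉),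
-- i.e. deg · |E|^T > C · (optNum + |E|^T · ⌈log₂ n⌉).
Bad : (G : BipGraph) (T C : ℕ) → Vec (Fin (nE G)) T → Bool
Bad G T C s =
  foldr (λ u acc → ⌊ (C * (optNum G T + sampleSize G T * ⌈log₂ nV G ⌉))
                       <? (degL (sampled G s) u * sampleSize G T) ⌋
                   ∨ acc)
        false (allFin (a G))

badCount : BipGraph → ℕ → ℕ → ℕ
badCount G T C = count (Bad G T C) (allSeqs T (nE G))

{-# OPTIONS --safe #-}
module Submission where

-- Fix S with Δ_L·|S| ≤ 4·e(S). In an optimal orientation of G'_T every sampled edge inside S
-- points into S, so |S|·OPT bounds the expected number T·e(S)/|E| of sampled edges inside S;
-- hence every left vertex u has expected degree μ = T·deg(u)/|E| ≤ T·Δ_L/|E| ≤ 4·OPT.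
-- The degree of u counts T independent draws, so Pr[deg ≥ k] ≤ C(T,k)(deg(u)/|E|)ᵏ ≤ μᵏ/k!,
-- which is at most 2⁻ᵏ once k ≥ 16μ because kᵏ ≤ 8ᵏ·k!. Taking k just above
-- (64 + c)(OPT + ⌈log₂ n⌉) makes this at most n^-(c+1), and a union bound over the at most n
-- left vertices leaves n^-c.

open import Defs

open import Data.Bool using (Bool; true; false; T; T?; _∧_; _∨_; if_then_else_)
import Data.Bool as Bool
open import Data.Bool.Properties using (T-∧)
open import Data.Empty using (⊥-elim)
open import Data.Fin as Fin using (Fin; _↑ˡ_; _↑ʳ_; splitAt)
open import Data.Fin.Properties using (_≟_; join-splitAt; splitAt-↑ˡ; splitAt-↑ʳ; ↑ˡ-injective; ↑ʳ-injective)
open import Data.Fin.Subset using (Subset; Nonempty; ∣_∣; inside; outside; ⁅_⁆; _⊆_)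
open import Data.Fin.Subset.Properties using (_∈?_; ∣⁅x⁆∣≡1; p⊆q⇒∣p∣≤∣q∣; x∈⁅y⁆⇒x≡y)
open import Data.List using (List; []; _∷_; _++_; length; map; foldr; concatMap; allFin; lookup; tabulate; replicate; zip)
open import Data.List.Membership.Propositional using (_∈_)
open import Data.List.Membership.Propositional.Properties using (∈-allFin; ∈-map⁺; ∈-map⁻; ∈-++⁺ˡ; foldr-selective)
open import Data.List.Properties using (map-++; map-tabulate; tabulate-lookup; length-tabulate; length-filter)
open import Data.List.Relation.Unary.All as All using (All; []; _∷_)
open import Data.List.Relation.Unary.All.Properties using (++⁺; map⁺)
open import Data.List.Relation.Unary.Any using (here; there)
open import Data.Nat using (ℕ; zero; suc; _+_; _*_; _^_; _!; _/_; _%_; _⊔_; _≤_; _<_; _≤ᵇ_; _<?_; z≤n; s≤s;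
                            ⌊_/2⌋; ⌈_/2⌉; NonZero; ≢-nonZero; >-nonZero)
open import Data.Nat.Combinatorics using (_C_; nCk+nC[k+1]≡[n+1]C[k+1])
open import Data.Nat.DivMod using (m≡m%n+[m/n]*n; m%n<n; m<n*o⇒m/o<n)
open import Data.Nat.Induction using (<-rec; <-wellFounded)
open import Data.Nat.ListAction using (sum)
open import Data.Nat.ListAction.Properties using (sum-++)
open import Data.Nat.Logarithm using (⌈log₂_⌉)
open import Data.Nat.Logarithm.Core using (⌈log2⌉)
open import Data.Nat.Properties hiding (_≟_)
import Data.Nat.Properties as ℕ
open import Algebra.Properties.CommutativeSemigroup +-commutativeSemigroup using () renaming (interchange to +-interchange)
open import Data.Nat.Tactic.RingSolver using (solve-∀)
open import Data.Product using (_×_; _,_; proj₁; proj₂; ∃-syntax)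
open import Data.Sum using (inj₁; inj₂)
open import Data.Vec as V using (Vec)
open import Function using (_∘_; id; case_of_)
open import Function.Bundles using (Equivalence)
open import Induction.WellFounded using (Acc; acc)
open import Relation.Binary.PropositionalEquality
open import Relation.Nullary using (yes; no)
open import Relation.Nullary.Decidable using (⌊_⌋; ⌊⌋-map′; isYes≗does; dec-true; toWitness; fromWitness)

toℕ : Bool → ℕ
toℕ false = 0
toℕ true  = 1

toℕ-mono : ∀ {a b} → (T a → T b) → toℕ a ≤ toℕ b
toℕ-mono {false}         _   = z≤n
toℕ-mono {true}  {true}  _   = ≤-refl
toℕ-mono {true}  {false} a⇒b = ⊥-elim (a⇒b _)

∑ : {A : Set} → List A → (A → ℕ) → ℕ
∑ xs f = sum (map f xs)

module _ {A : Set} where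

  ∑-cong : {f g : A → ℕ} → (∀ x → f x ≡ g x) → ∀ xs → ∑ xs f ≡ ∑ xs g
  ∑-cong f≗g []       = refl
  ∑-cong f≗g (x ∷ xs) = cong₂ _+_ (f≗g x) (∑-cong f≗g xs)

  ∑-mono-≤ : {f g : A → ℕ} → (∀ x → f x ≤ g x) → ∀ xs → ∑ xs f ≤ ∑ xs g
  ∑-mono-≤ f≤g []       = z≤n
  ∑-mono-≤ f≤g (x ∷ xs) = +-mono-≤ (f≤g x) (∑-mono-≤ f≤g xs)

  ∑-distrib-+ : ∀ (f g : A → ℕ) xs → ∑ xs (λ x → f x + g x) ≡ ∑ xs f + ∑ xs g
  ∑-distrib-+ f g []       = refl
  ∑-distrib-+ f g (x ∷ xs) =
    trans (cong (f x + g x +_) (∑-distrib-+ f g xs)) (+-interchange (f x) (g x) (∑ xs f) (∑ xs g))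

  ∑-distribʳ-* : ∀ (f : A → ℕ) c xs → ∑ xs (λ x → f x * c) ≡ ∑ xs f * c
  ∑-distribʳ-* f c []       = refl
  ∑-distribʳ-* f c (x ∷ xs) =
    trans (cong (f x * c +_) (∑-distribʳ-* f c xs)) (sym (*-distribʳ-+ c (f x) (∑ xs f)))

  ∑-distribˡ-* : ∀ c (f : A → ℕ) xs → ∑ xs (λ x → c * f x) ≡ c * ∑ xs f
  ∑-distribˡ-* c f []       = sym (*-zeroʳ c)
  ∑-distribˡ-* c f (x ∷ xs) =
    trans (cong (c * f x +_) (∑-distribˡ-* c f xs)) (sym (*-distribˡ-+ c (f x) (∑ xs f)))

  ∑-const : ∀ c (xs : List A) → ∑ xs (λ _ → c) ≡ length xs * c
  ∑-const c []       = refl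
  ∑-const c (x ∷ xs) = cong (c +_) (∑-const c xs)

  ∈⇒≤∑ : ∀ (f : A → ℕ) {x xs} → x ∈ xs → f x ≤ ∑ xs f
  ∈⇒≤∑ f (here refl)  = m≤m+n _ _
  ∈⇒≤∑ f (there x∈xs) = ≤-trans (∈⇒≤∑ f x∈xs) (m≤n+m _ _)

  count-∷ : ∀ (p : A → Bool) x xs → count p (x ∷ xs) ≡ toℕ (p x) + count p xs
  count-∷ p x xs with p x
  ... | true  = refl
  ... | false = refl

  count≡∑ : ∀ (p : A → Bool) xs → count p xs ≡ ∑ xs (toℕ ∘ p)
  count≡∑ p []       = refl
  count≡∑ p (x ∷ xs) = trans (count-∷ p x xs) (cong (toℕ (p x) +_) (count≡∑ p xs))

  count≤length : ∀ (p : A → Bool) xs → count p xs ≤ length xs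
  count≤length p = length-filter (T? ∘ p)

  count-cong : {p q : A → Bool} → (∀ x → p x ≡ q x) → ∀ xs → count p xs ≡ count q xs
  count-cong {p} {q} p≗q xs = begin
    count p xs        ≡⟨ count≡∑ p xs ⟩
    ∑ xs (toℕ ∘ p)    ≡⟨ ∑-cong (cong toℕ ∘ p≗q) xs ⟩
    ∑ xs (toℕ ∘ q)    ≡⟨ count≡∑ q xs ⟨
    count q xs        ∎
    where open ≡-Reasoning

  count-∨ : ∀ (p q : A → Bool) xs → count (λ x → p x ∨ q x) xs ≤ count p xs + count q xs
  count-∨ p q xs = begin
    count _ xs                               ≡⟨ count≡∑ _ xs ⟩
    ∑ xs (λ x → toℕ (p x ∨ q x))             ≤⟨ ∑-mono-≤ (λ x → toℕ-∨ (p x) (q x)) xs ⟩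
    ∑ xs (λ x → toℕ (p x) + toℕ (q x))       ≡⟨ ∑-distrib-+ (toℕ ∘ p) (toℕ ∘ q) xs ⟩
    ∑ xs (toℕ ∘ p) + ∑ xs (toℕ ∘ q)          ≡⟨ cong₂ _+_ (count≡∑ p xs) (count≡∑ q xs) ⟨
    count p xs + count q xs                  ∎
    where open ≤-Reasoning
          toℕ-∨ : ∀ a b → toℕ (a ∨ b) ≤ toℕ a + toℕ b
          toℕ-∨ false b = ≤-refl
          toℕ-∨ true  b = m≤m+n 1 (toℕ b)

  count-false : ∀ (xs : List A) → count (λ _ → false) xs ≡ 0
  count-false []       = refl
  count-false (x ∷ xs) = count-false xs

  count-mono : {p q : A → Bool} → (∀ x → T (p x) → T (q x)) → ∀ xs → count p xs ≤ count q xs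
  count-mono {p} {q} p⇒q xs = begin
    count p xs         ≡⟨ count≡∑ p xs ⟩
    ∑ xs (toℕ ∘ p)     ≤⟨ ∑-mono-≤ (λ x → toℕ-mono (p⇒q x)) xs ⟩
    ∑ xs (toℕ ∘ q)     ≡⟨ count≡∑ q xs ⟨
    count q xs         ∎
    where open ≤-Reasoning

module _ {A B : Set} where

  ∑-map : ∀ (f : B → ℕ) (g : A → B) xs → ∑ (map g xs) f ≡ ∑ xs (f ∘ g)
  ∑-map f g []       = refl
  ∑-map f g (x ∷ xs) = cong (f (g x) +_) (∑-map f g xs)

  ∑-concatMap : ∀ (f : B → ℕ) (g : A → List B) xs → ∑ (concatMap g xs) f ≡ ∑ xs (λ x → ∑ (g x) f)
  ∑-concatMap f g []       = refl
  ∑-concatMap f g (x ∷ xs) = begin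
    sum (map f (g x ++ concatMap g xs))         ≡⟨ cong sum (map-++ f (g x) _) ⟩
    sum (map f (g x) ++ map f (concatMap g xs)) ≡⟨ sum-++ (map f (g x)) _ ⟩
    ∑ (g x) f + ∑ (concatMap g xs) f            ≡⟨ cong (∑ (g x) f +_) (∑-concatMap f g xs) ⟩
    ∑ (g x) f + ∑ xs (λ x → ∑ (g x) f)          ∎
    where open ≡-Reasoning

  count-map : ∀ (p : B → Bool) (f : A → B) xs → count p (map f xs) ≡ count (p ∘ f) xs
  count-map p f []       = refl
  count-map p f (x ∷ xs) = begin
    count p (map f (x ∷ xs))           ≡⟨ count-∷ p (f x) (map f xs) ⟩
    toℕ (p (f x)) + count p (map f xs) ≡⟨ cong (toℕ (p (f x)) +_) (count-map p f xs) ⟩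
    toℕ (p (f x)) + count (p ∘ f) xs   ≡⟨ count-∷ (p ∘ f) x xs ⟨
    count (p ∘ f) (x ∷ xs)             ∎
    where open ≡-Reasoning

  count-⋁ : ∀ (p : B → A → Bool) us xs →
            count (λ x → foldr (λ u acc → p u x ∨ acc) false us) xs ≤ ∑ us (λ u → count (p u) xs)
  count-⋁ p []       xs = ≤-reflexive (count-false xs)
  count-⋁ p (u ∷ us) xs =
    ≤-trans (count-∨ (p u) _ xs) (+-monoʳ-≤ (count (p u) xs) (count-⋁ p us xs))

length-allFin : ∀ n → length (allFin n) ≡ n
length-allFin n = length-tabulate id

length≡∑1 : {A : Set} (xs : List A) → length xs ≡ ∑ xs (λ _ → 1)
length≡∑1 xs = sym (trans (∑-const 1 xs) (*-identityʳ (length xs)))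

∑-allFin-lookup : {A : Set} (f : A → ℕ) (xs : List A) → ∑ (allFin (length xs)) (f ∘ lookup xs) ≡ ∑ xs f
∑-allFin-lookup f xs = begin
  ∑ (allFin (length xs)) (f ∘ lookup xs)    ≡⟨ ∑-map f (lookup xs) (allFin (length xs)) ⟨
  ∑ (map (lookup xs) (tabulate id)) f       ≡⟨ cong (λ ys → ∑ ys f) (map-tabulate id (lookup xs)) ⟩
  ∑ (tabulate (lookup xs)) f                ≡⟨ cong (λ ys → ∑ ys f) (tabulate-lookup xs) ⟩
  ∑ xs f                                    ∎
  where open ≡-Reasoning

∑-allSeqs-suc : ∀ T m (φ : Vec (Fin m) (suc T) → ℕ) →
                ∑ (allSeqs (suc T) m) φ ≡ ∑ (allFin m) (λ i → ∑ (allSeqs T m) (φ ∘ (i V.∷_)))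
∑-allSeqs-suc T m φ = trans (∑-concatMap φ _ (allFin m))
                            (∑-cong (λ i → ∑-map φ (i V.∷_) (allSeqs T m)) (allFin m))

length-allSeqs : ∀ T m → length (allSeqs T m) ≡ m ^ T
length-allSeqs zero    m = refl
length-allSeqs (suc T) m = begin
  length (allSeqs (suc T) m)                          ≡⟨ length≡∑1 (allSeqs (suc T) m) ⟩
  ∑ (allSeqs (suc T) m) (λ _ → 1)                     ≡⟨ ∑-allSeqs-suc T m (λ _ → 1) ⟩
  ∑ (allFin m) (λ _ → ∑ (allSeqs T m) (λ _ → 1))      ≡⟨ ∑-const _ (allFin m) ⟩
  length (allFin m) * ∑ (allSeqs T m) (λ _ → 1)       ≡⟨ cong₂ _*_ (length-allFin m) (sym (length≡∑1 (allSeqs T m))) ⟩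
  m * length (allSeqs T m)                            ≡⟨ cong (m *_) (length-allSeqs T m) ⟩
  m * m ^ T                                           ∎
  where open ≡-Reasoning

^-distribʳ-* : ∀ m n o → (m * n) ^ o ≡ m ^ o * n ^ o
^-distribʳ-* m n zero    = refl
^-distribʳ-* m n (suc o) = begin
  m * n * (m * n) ^ o       ≡⟨ cong (m * n *_) (^-distribʳ-* m n o) ⟩
  m * n * (m ^ o * n ^ o)   ≡⟨ x*y*[z*w]≡x*z*[y*w] m n (m ^ o) (n ^ o) ⟩
  m * m ^ o * (n * n ^ o)   ∎
  where open ≡-Reasoning
        x*y*[z*w]≡x*z*[y*w] : ∀ x y z w → x * y * (z * w) ≡ x * z * (y * w)
        x*y*[z*w]≡x*z*[y*w] = solve-∀

bernoulli : ∀ n k → n ^ suc k + suc k * n ^ k ≤ suc n ^ suc k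
bernoulli n zero    = ≤-reflexive (n*1+1≡[1+n]*1 n)
  where n*1+1≡[1+n]*1 : ∀ n → n * 1 + 1 * 1 ≡ suc n * 1
        n*1+1≡[1+n]*1 = solve-∀
bernoulli n (suc k) = begin
  n * (n * X) + suc (suc k) * (n * X)      ≤⟨ m≤m+n _ (suc k * X) ⟩
  n * (n * X) + suc (suc k) * (n * X) + suc k * X
                                           ≡⟨ expand n k X ⟩
  suc n * (n * X + suc k * X)              ≤⟨ *-monoʳ-≤ (suc n) (bernoulli n k) ⟩
  suc n * suc n ^ suc k                    ∎
  where open ≤-Reasoning
        X = n ^ k
        expand : ∀ n k X → n * (n * X) + suc (suc k) * (n * X) + suc k * X ≡ suc n * (n * X + suc k * X)
        expand = solve-∀

nCk*k!≤nᵏ : ∀ n k → (n C k) * k ! ≤ n ^ k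
nCk*k!≤nᵏ n       zero    = ≤-refl
nCk*k!≤nᵏ zero    (suc k) = z≤n
nCk*k!≤nᵏ (suc n) (suc k) = begin
  (suc n C suc k) * (suc k * k !)                       ≡⟨ cong (_* (suc k * k !)) (nCk+nC[k+1]≡[n+1]C[k+1] n k) ⟨
  (n C k + n C suc k) * (suc k * k !)                   ≡⟨ pascal-split (n C k) (n C suc k) (suc k) (k !) ⟩
  (n C suc k) * (suc k * k !) + suc k * ((n C k) * k !) ≤⟨ +-mono-≤ (nCk*k!≤nᵏ n (suc k)) (*-monoʳ-≤ (suc k) (nCk*k!≤nᵏ n k)) ⟩
  n ^ suc k + suc k * n ^ k                             ≤⟨ bernoulli n k ⟩
  suc n ^ suc k                                         ∎
  where open ≤-Reasoning
        pascal-split : ∀ a b c f → (a + b) * (c * f) ≡ b * (c * f) + c * (a * f)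
        pascal-split = solve-∀

m!*mⁿ≤[m+n]! : ∀ m n → m ! * m ^ n ≤ (m + n) !
m!*mⁿ≤[m+n]! m zero    = ≤-reflexive (trans (*-identityʳ (m !)) (cong _! (sym (+-identityʳ m))))
m!*mⁿ≤[m+n]! m (suc n) = begin
  m ! * (m * m ^ n)        ≡⟨ x*[y*z]≡y*[x*z] (m !) m (m ^ n) ⟩
  m * (m ! * m ^ n)        ≤⟨ *-mono-≤ (≤-trans (m≤m+n m n) (n≤1+n (m + n))) (m!*mⁿ≤[m+n]! m n) ⟩
  suc (m + n) * (m + n) !  ≡⟨ cong _! (+-suc m n) ⟨
  (m + suc n) !            ∎
  where open ≤-Reasoning
        x*[y*z]≡y*[x*z] : ∀ x y z → x * (y * z) ≡ y * (x * z)
        x*[y*z]≡y*[x*z] = solve-∀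

kᵏ≤8ᵏ*k! : ∀ k → k ^ k ≤ 8 ^ k * k !
kᵏ≤8ᵏ*k! = <-rec P step
  where
  P : ℕ → Set
  P k = k ^ k ≤ 8 ^ k * k !

  halves : ∀ k → ⌈ k /2⌉ + ⌊ k /2⌋ ≡ k
  halves k = trans (+-comm ⌈ k /2⌉ ⌊ k /2⌋) (⌊n/2⌋+⌈n/2⌉≡n k)

  ⌈k/2⌉≤2*⌊k/2⌋ : ∀ n → ⌈ suc (suc n) /2⌉ ≤ 2 * ⌊ suc (suc n) /2⌋
  ⌈k/2⌉≤2*⌊k/2⌋ n = s≤s (begin
    ⌊ suc n /2⌋                   ≤⟨ ⌊n/2⌋-mono (n≤1+n (suc n)) ⟩
    suc ⌊ n /2⌋                   ≤⟨ m≤n+m _ ⌊ n /2⌋ ⟩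
    ⌊ n /2⌋ + suc ⌊ n /2⌋         ≡⟨ cong (⌊ n /2⌋ +_) (*-identityˡ _) ⟨
    ⌊ n /2⌋ + 1 * suc ⌊ n /2⌋     ∎)
    where open ≤-Reasoning

  -- k! ≥ h! hˡ for k = h + l, and kᵏ ≤ (2h)ᵏ = 2ᵏ hʰ hˡ, while 2ᵏ ≤ 8ˡ because k ≤ 3l.
  halving : ∀ {h l} → l ≤ h → h ≤ 2 * l → h ^ h ≤ 8 ^ h * h ! → (h + l) ^ (h + l) ≤ 8 ^ (h + l) * (h + l) !
  halving {h} {l} l≤h h≤2l ih = begin
    (h + l) ^ (h + l)                    ≤⟨ ^-monoˡ-≤ (h + l) (≤-trans (+-monoʳ-≤ h l≤h) (≤-reflexive (h+h≡2*h h))) ⟩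
    (2 * h) ^ (h + l)                    ≡⟨ ^-distribʳ-* 2 h (h + l) ⟩
    2 ^ (h + l) * h ^ (h + l)            ≡⟨ cong (2 ^ (h + l) *_) (^-distribˡ-+-* h h l) ⟩
    2 ^ (h + l) * (h ^ h * h ^ l)        ≤⟨ *-monoʳ-≤ (2 ^ (h + l)) (*-monoˡ-≤ (h ^ l) ih) ⟩
    2 ^ (h + l) * (8 ^ h * h ! * h ^ l)  ≤⟨ *-monoˡ-≤ _ (^-monoʳ-≤ 2 (≤-trans (+-monoˡ-≤ l h≤2l) (≤-reflexive (2*l+l≡3*l l)))) ⟩
    2 ^ (3 * l) * (8 ^ h * h ! * h ^ l)  ≡⟨ cong (_* (8 ^ h * h ! * h ^ l)) (^-*-assoc 2 3 l) ⟨
    8 ^ l * (8 ^ h * h ! * h ^ l)        ≡⟨ rearrange (8 ^ l) (8 ^ h) (h !) (h ^ l) ⟩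
    8 ^ h * 8 ^ l * (h ! * h ^ l)        ≤⟨ *-monoʳ-≤ (8 ^ h * 8 ^ l) (m!*mⁿ≤[m+n]! h l) ⟩
    8 ^ h * 8 ^ l * (h + l) !            ≡⟨ cong (_* (h + l) !) (^-distribˡ-+-* 8 h l) ⟨
    8 ^ (h + l) * (h + l) !              ∎
    where open ≤-Reasoning
          h+h≡2*h : ∀ h → h + h ≡ 2 * h
          h+h≡2*h = solve-∀
          2*l+l≡3*l : ∀ l → 2 * l + l ≡ 3 * l
          2*l+l≡3*l = solve-∀
          rearrange : ∀ a b c d → a * (b * c * d) ≡ b * a * (c * d)
          rearrange = solve-∀

  step : ∀ k → (∀ {j} → j < k → P j) → P k
  step zero            _   = ≤-refl
  step (suc zero)      _   = s≤s z≤n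
  step k@(suc (suc n)) rec = subst P (halves k) (halving (⌊n/2⌋≤⌈n/2⌉ k) (⌈k/2⌉≤2*⌊k/2⌋ n) (rec (⌈n/2⌉<n n)))

binomial-tail : ∀ {M} N T k d m .{{_ : NonZero m}} →
                N * m ^ k ≤ (T C k) * d ^ k * M → 16 * (T * d) ≤ k * m → N * 2 ^ k ≤ M
binomial-tail {M} N T k d m tail 16Td≤km = *-cancelʳ-≤ (N * 2 ^ k) M Q (begin
  N * 2 ^ k * Q                              ≡⟨ rearrange₁ N (2 ^ k) (8 ^ k) (m ^ k) (k !) ⟩
  N * m ^ k * (2 ^ k * 8 ^ k * k !)          ≡⟨ cong (λ x → N * m ^ k * (x * k !)) (^-distribʳ-* 2 8 k) ⟨
  N * m ^ k * (16 ^ k * k !)                 ≤⟨ *-monoˡ-≤ (16 ^ k * k !) tail ⟩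
  (T C k) * d ^ k * M * (16 ^ k * k !)       ≡⟨ rearrange₂ (T C k) (d ^ k) M (16 ^ k) (k !) ⟩
  (T C k) * k ! * (16 ^ k * d ^ k) * M       ≤⟨ *-monoˡ-≤ M (*-monoˡ-≤ (16 ^ k * d ^ k) (nCk*k!≤nᵏ T k)) ⟩
  T ^ k * (16 ^ k * d ^ k) * M               ≡⟨ cong (_* M) (^-distrib₃ T 16 d) ⟩
  (16 * (T * d)) ^ k * M                     ≤⟨ *-monoˡ-≤ M (^-monoˡ-≤ k 16Td≤km) ⟩
  (k * m) ^ k * M                            ≡⟨ cong (_* M) (^-distribʳ-* k m k) ⟩
  k ^ k * m ^ k * M                          ≤⟨ *-monoˡ-≤ M (*-monoˡ-≤ (m ^ k) (kᵏ≤8ᵏ*k! k)) ⟩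
  8 ^ k * k ! * m ^ k * M                    ≡⟨ rearrange₃ (8 ^ k) (k !) (m ^ k) M ⟩
  M * Q                                      ∎)
  where
  open ≤-Reasoning
  Q = 8 ^ k * (m ^ k * k !)
  instance
    _ : NonZero Q
    _ = m*n≢0 (8 ^ k) (m ^ k * k !) {{m^n≢0 8 k}} {{m*n≢0 (m ^ k) (k !) {{m^n≢0 m k}} {{k !≢0}}}}
  ^-distrib₃ : ∀ T c d → T ^ k * (c ^ k * d ^ k) ≡ (c * (T * d)) ^ k
  ^-distrib₃ T c d = begin-equality
    T ^ k * (c ^ k * d ^ k)   ≡⟨ x*[y*z]≡y*[x*z] (T ^ k) (c ^ k) (d ^ k) ⟩
    c ^ k * (T ^ k * d ^ k)   ≡⟨ cong (c ^ k *_) (^-distribʳ-* T d k) ⟨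
    c ^ k * (T * d) ^ k       ≡⟨ ^-distribʳ-* c (T * d) k ⟨
    (c * (T * d)) ^ k         ∎
    where x*[y*z]≡y*[x*z] : ∀ x y z → x * (y * z) ≡ y * (x * z)
          x*[y*z]≡y*[x*z] = solve-∀
  rearrange₁ : ∀ a b c d e → a * b * (c * (d * e)) ≡ a * d * (b * c * e)
  rearrange₁ = solve-∀
  rearrange₂ : ∀ a b c d e → a * b * c * (d * e) ≡ a * e * (d * b) * c
  rearrange₂ = solve-∀
  rearrange₃ : ∀ a b c d → a * b * c * d ≡ d * (a * (c * b))
  rearrange₃ = solve-∀

n≤2^⌈log₂n⌉ : ∀ n → n ≤ 2 ^ ⌈log₂ n ⌉
n≤2^⌈log₂n⌉ n = bound n (<-wellFounded n)
  where
  bound : ∀ n (acc : Acc _<_ n) → n ≤ 2 ^ ⌈log2⌉ n acc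
  bound zero                _         = z≤n
  bound (suc zero)          _         = ≤-refl
  bound (suc (suc n)) (acc _)  = begin
    2 + n                               ≡⟨ cong (2 +_) (⌊n/2⌋+⌈n/2⌉≡n n) ⟨
    2 + (⌊ n /2⌋ + ⌈ n /2⌉)             ≤⟨ +-monoʳ-≤ 2 (+-monoˡ-≤ ⌈ n /2⌉ (⌊n/2⌋≤⌈n/2⌉ n)) ⟩
    2 + (⌈ n /2⌉ + ⌈ n /2⌉)             ≡⟨ 2+[x+x]≡2*[1+x] ⌈ n /2⌉ ⟩
    2 * suc ⌈ n /2⌉                     ≤⟨ *-monoʳ-≤ 2 (bound (suc ⌈ n /2⌉) _) ⟩
    2 * 2 ^ ⌈log2⌉ (suc ⌈ n /2⌉) _      ∎
    where open ≤-Reasoning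
          2+[x+x]≡2*[1+x] : ∀ x → 2 + (x + x) ≡ 2 * suc x
          2+[x+x]≡2*[1+x] = solve-∀

-- T uniform draws from es; probabilities are counts over the mᵀ equally likely draw sequences.
module Draws {A : Set} (es : List A) (P : A → Bool) where

  m : ℕ
  m = length es

  d : ℕ
  d = count P es

  hits : ∀ {T} → Vec (Fin m) T → ℕ
  hits s = count P (V.toList (V.map (lookup es) s))

  hits-∷ : ∀ {T} i (s : Vec (Fin m) T) → hits (i V.∷ s) ≡ toℕ (P (lookup es i)) + hits s
  hits-∷ i s = count-∷ P (lookup es i) _

  ∑-draw : ∑ (allFin m) (toℕ ∘ P ∘ lookup es) ≡ d
  ∑-draw = trans (∑-allFin-lookup (toℕ ∘ P) es) (sym (count≡∑ P es))

  ∑-hits-suc : ∀ T → ∑ (allSeqs (suc T) m) hits ≡ d * m ^ T + m * ∑ (allSeqs T m) hits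
  ∑-hits-suc T = begin
    ∑ (allSeqs (suc T) m) hits
      ≡⟨ ∑-allSeqs-suc T m hits ⟩
    ∑ (allFin m) (λ i → ∑ L (λ s → hits (i V.∷ s)))
      ≡⟨ ∑-cong (λ i → trans (∑-cong (hits-∷ i) L) (∑-distrib-+ _ hits L)) (allFin m) ⟩
    ∑ (allFin m) (λ i → ∑ L (λ _ → toℕ (P (lookup es i))) + ∑ L hits)
      ≡⟨ ∑-distrib-+ _ _ (allFin m) ⟩
    ∑ (allFin m) (λ i → ∑ L (λ _ → toℕ (P (lookup es i)))) + ∑ (allFin m) (λ _ → ∑ L hits)
      ≡⟨ cong₂ _+_ (∑-cong (λ i → trans (∑-const _ L) (*-comm (length L) _)) (allFin m)) (∑-const _ (allFin m)) ⟩
    ∑ (allFin m) (λ i → toℕ (P (lookup es i)) * length L) + length (allFin m) * ∑ L hits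
      ≡⟨ cong₂ _+_ (trans (∑-distribʳ-* _ (length L) (allFin m)) (cong₂ _*_ ∑-draw (length-allSeqs T m)))
                   (cong (_* ∑ L hits) (length-allFin m)) ⟩
    d * m ^ T + m * ∑ L hits
      ∎
    where open ≡-Reasoning
          L = allSeqs T m

  ∑-hits : ∀ T → m * ∑ (allSeqs T m) hits ≡ T * d * m ^ T
  ∑-hits zero    = *-zeroʳ m
  ∑-hits (suc T) = begin
    m * ∑ (allSeqs (suc T) m) hits         ≡⟨ cong (m *_) (∑-hits-suc T) ⟩
    m * (d * m ^ T + m * ∑ L hits)         ≡⟨ cong (λ x → m * (d * m ^ T + x)) (∑-hits T) ⟩
    m * (d * m ^ T + T * d * m ^ T)        ≡⟨ collect m d T (m ^ T) ⟩
    suc T * d * (m * m ^ T)                ∎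
    where open ≡-Reasoning
          L = allSeqs T m
          collect : ∀ m d T X → m * (d * X + T * d * X) ≡ suc T * d * (m * X)
          collect = solve-∀

  atLeast : ℕ → ℕ → ℕ
  atLeast T k = count (λ s → k ≤ᵇ hits s) (allSeqs T m)

  atLeast-after : ∀ T k b → ∑ (allSeqs T m) (λ s → toℕ (suc k ≤ᵇ toℕ b + hits s)) ≤ toℕ b * atLeast T k + atLeast T (suc k)
  atLeast-after T k true  = begin
    ∑ L (λ s → toℕ (suc k ≤ᵇ suc (hits s)))   ≡⟨ ∑-cong (λ s → cong toℕ (≤ᵇ-suc k (hits s))) L ⟩
    ∑ L (λ s → toℕ (k ≤ᵇ hits s))             ≡⟨ count≡∑ _ L ⟨
    atLeast T k                               ≡⟨ +-identityʳ _ ⟨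
    atLeast T k + 0                           ≤⟨ m≤m+n _ _ ⟩
    1 * atLeast T k + atLeast T (suc k)       ∎
    where open ≤-Reasoning
          L = allSeqs T m
          ≤ᵇ-suc : ∀ k x → (suc k ≤ᵇ suc x) ≡ (k ≤ᵇ x)
          ≤ᵇ-suc zero    x = refl
          ≤ᵇ-suc (suc k) x = refl
  atLeast-after T k false = ≤-reflexive (sym (count≡∑ _ (allSeqs T m)))

  atLeast-suc : ∀ T k → atLeast (suc T) (suc k) ≤ d * atLeast T k + m * atLeast T (suc k)
  atLeast-suc T k = begin
    atLeast (suc T) (suc k)
      ≡⟨ trans (count≡∑ _ (allSeqs (suc T) m)) (∑-allSeqs-suc T m _) ⟩
    ∑ (allFin m) (λ i → ∑ L (λ s → toℕ (suc k ≤ᵇ hits (i V.∷ s))))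
      ≡⟨ ∑-cong (λ i → ∑-cong (λ s → cong (λ h → toℕ (suc k ≤ᵇ h)) (hits-∷ i s)) L) (allFin m) ⟩
    ∑ (allFin m) (λ i → ∑ L (λ s → toℕ (suc k ≤ᵇ toℕ (P (lookup es i)) + hits s)))
      ≤⟨ ∑-mono-≤ (λ i → atLeast-after T k (P (lookup es i))) (allFin m) ⟩
    ∑ (allFin m) (λ i → toℕ (P (lookup es i)) * atLeast T k + atLeast T (suc k))
      ≡⟨ ∑-distrib-+ _ _ (allFin m) ⟩
    ∑ (allFin m) (λ i → toℕ (P (lookup es i)) * atLeast T k) + ∑ (allFin m) (λ _ → atLeast T (suc k))
      ≡⟨ cong₂ _+_ (trans (∑-distribʳ-* _ _ (allFin m)) (cong (_* atLeast T k) ∑-draw))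
                   (trans (∑-const _ (allFin m)) (cong (_* atLeast T (suc k)) (length-allFin m))) ⟩
    d * atLeast T k + m * atLeast T (suc k)
      ∎
    where open ≤-Reasoning
          L = allSeqs T m

  -- Pr[hits ≥ k] ≤ C(T,k)·(d/m)ᵏ, a union bound over the k-sets of draws.
  atLeast-bound : ∀ T k → atLeast T k * m ^ k ≤ (T C k) * d ^ k * m ^ T
  atLeast-bound T       zero    = ≤-reflexive (begin-equality
    atLeast T 0 * 1             ≡⟨ *-identityʳ _ ⟩
    atLeast T 0                 ≡⟨ count≡∑ _ (allSeqs T m) ⟩
    ∑ (allSeqs T m) (λ _ → 1)   ≡⟨ length≡∑1 (allSeqs T m) ⟨
    length (allSeqs T m)        ≡⟨ length-allSeqs T m ⟩
    m ^ T                       ≡⟨ *-identityˡ (m ^ T) ⟨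
    1 * 1 * m ^ T               ∎)
    where open ≤-Reasoning
  atLeast-bound zero    (suc k) = z≤n
  atLeast-bound (suc T) (suc k) = begin
    atLeast (suc T) (suc k) * (m * m ^ k)
      ≤⟨ *-monoˡ-≤ (m * m ^ k) (atLeast-suc T k) ⟩
    (d * atLeast T k + m * atLeast T (suc k)) * (m * m ^ k)
      ≡⟨ distribute d (atLeast T k) m (atLeast T (suc k)) (m ^ k) ⟩
    d * m * (atLeast T k * m ^ k) + m * (atLeast T (suc k) * (m * m ^ k))
      ≤⟨ +-mono-≤ (*-monoʳ-≤ (d * m) (atLeast-bound T k)) (*-monoʳ-≤ m (atLeast-bound T (suc k))) ⟩
    d * m * ((T C k) * d ^ k * m ^ T) + m * ((T C suc k) * (d * d ^ k) * m ^ T)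
      ≡⟨ collect d m (T C k) (T C suc k) (d ^ k) (m ^ T) ⟩
    (T C k + T C suc k) * (d * d ^ k) * (m * m ^ T)
      ≡⟨ cong (λ c → c * (d * d ^ k) * (m * m ^ T)) (nCk+nC[k+1]≡[n+1]C[k+1] T k) ⟩
    (suc T C suc k) * (d * d ^ k) * (m * m ^ T)
      ∎
    where open ≤-Reasoning
          distribute : ∀ d A m B Y → (d * A + m * B) * (m * Y) ≡ d * m * (A * Y) + m * (B * (m * Y))
          distribute = solve-∀
          collect : ∀ d m a b D X → d * m * (a * D * X) + m * (b * (d * D) * X) ≡ (a + b) * (d * D) * (m * X)
          collect = solve-∀

  atLeast-tail : ∀ T k → 16 * (T * d) ≤ k * m → atLeast T k * 2 ^ k ≤ m ^ T
  atLeast-tail zero    zero    _       = ≤-refl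
  atLeast-tail zero    (suc k) _       = z≤n
  atLeast-tail (suc T) k       16Td≤km with m ℕ.≟ 0
  ... | no  m≢0 = binomial-tail (atLeast (suc T) k) (suc T) k d m {{≢-nonZero m≢0}} (atLeast-bound (suc T) k) 16Td≤km
  ... | yes m≡0 = begin
    atLeast (suc T) k * 2 ^ k                 ≤⟨ *-monoˡ-≤ (2 ^ k) (count≤length _ (allSeqs (suc T) m)) ⟩
    length (allSeqs (suc T) m) * 2 ^ k        ≡⟨ cong (_* 2 ^ k) (trans (length-allSeqs (suc T) m) (cong (_* m ^ T) m≡0)) ⟩
    0                                         ≤⟨ z≤n ⟩
    m ^ suc T                                 ∎
    where open ≤-Reasoning

count-∈-∷ : ∀ {n} x (S : Subset n) →
            count (λ w → ⌊ w ∈? (x V.∷ S) ⌋) (tabulate Fin.suc) ≡ count (λ w → ⌊ w ∈? S ⌋) (allFin n)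
count-∈-∷ {n} x S = begin
  count ∈x∷S (tabulate Fin.suc)       ≡⟨ cong (count ∈x∷S) (map-tabulate id Fin.suc) ⟨
  count ∈x∷S (map Fin.suc (allFin n)) ≡⟨ count-map ∈x∷S Fin.suc (allFin n) ⟩
  count (∈x∷S ∘ Fin.suc) (allFin n)   ≡⟨ count-cong (λ w → ⌊⌋-map′ _ _ (w ∈? S)) (allFin n) ⟩
  count (λ w → ⌊ w ∈? S ⌋) (allFin n) ∎
  where open ≡-Reasoning
        ∈x∷S : Fin (suc n) → Bool
        ∈x∷S w = ⌊ w ∈? (x V.∷ S) ⌋

∣S∣≡count-∈ : ∀ {n} (S : Subset n) → ∣ S ∣ ≡ count (λ w → ⌊ w ∈? S ⌋) (allFin n)
∣S∣≡count-∈ V.[]            = refl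
∣S∣≡count-∈ (inside  V.∷ S) = cong suc (trans (∣S∣≡count-∈ S) (sym (count-∈-∷ inside S)))
∣S∣≡count-∈ (outside V.∷ S) = trans (∣S∣≡count-∈ S) (sym (count-∈-∷ outside S))

module _ {X : Set} {n : ℕ} (f : X → Fin n) (S : Subset n) where

  private
    [_∈S] : Fin n → ℕ
    [ w ∈S] = toℕ ⌊ w ∈? S ⌋

    fibre : Fin n → List X → ℕ
    fibre w = count (λ x → ⌊ f x ≟ w ⌋)

  count-∈≤∑fibres : ∀ xs → count (λ x → ⌊ f x ∈? S ⌋) xs ≤ ∑ (allFin n) (λ w → [ w ∈S] * fibre w xs)
  count-∈≤∑fibres []       = z≤n
  count-∈≤∑fibres (x ∷ xs) = begin
    count (λ x → ⌊ f x ∈? S ⌋) (x ∷ xs)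
      ≡⟨ count-∷ _ x xs ⟩
    [ f x ∈S] + count (λ x → ⌊ f x ∈? S ⌋) xs
      ≤⟨ +-mono-≤ hit (count-∈≤∑fibres xs) ⟩
    ∑ (allFin n) (λ w → [ w ∈S] * toℕ ⌊ f x ≟ w ⌋) + ∑ (allFin n) (λ w → [ w ∈S] * fibre w xs)
      ≡⟨ ∑-distrib-+ _ _ (allFin n) ⟨
    ∑ (allFin n) (λ w → [ w ∈S] * toℕ ⌊ f x ≟ w ⌋ + [ w ∈S] * fibre w xs)
      ≡⟨ ∑-cong (λ w → trans (sym (*-distribˡ-+ [ w ∈S] _ _)) (cong ([ w ∈S] *_) (sym (count-∷ _ x xs)))) (allFin n) ⟩
    ∑ (allFin n) (λ w → [ w ∈S] * fibre w (x ∷ xs))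
      ∎
    where
    open ≤-Reasoning
    hit : [ f x ∈S] ≤ ∑ (allFin n) (λ w → [ w ∈S] * toℕ ⌊ f x ≟ w ⌋)
    hit = begin
      [ f x ∈S]                             ≡⟨ *-identityʳ _ ⟨
      [ f x ∈S] * 1                         ≡⟨ cong (λ b → [ f x ∈S] * toℕ b) (trans (isYes≗does (f x ≟ f x)) (dec-true (f x ≟ f x) refl)) ⟨
      [ f x ∈S] * toℕ ⌊ f x ≟ f x ⌋         ≤⟨ ∈⇒≤∑ (λ w → [ w ∈S] * toℕ ⌊ f x ≟ w ⌋) (∈-allFin (f x)) ⟩
      ∑ (allFin n) (λ w → [ w ∈S] * toℕ ⌊ f x ≟ w ⌋) ∎

  count-∈≤∣S∣* : ∀ {B} xs → (∀ w → fibre w xs ≤ B) → count (λ x → ⌊ f x ∈? S ⌋) xs ≤ ∣ S ∣ * B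
  count-∈≤∣S∣* {B} xs fibre≤B = begin
    count (λ x → ⌊ f x ∈? S ⌋) xs                ≤⟨ count-∈≤∑fibres xs ⟩
    ∑ (allFin n) (λ w → [ w ∈S] * fibre w xs)    ≤⟨ ∑-mono-≤ (λ w → *-monoʳ-≤ [ w ∈S] (fibre≤B w)) (allFin n) ⟩
    ∑ (allFin n) (λ w → [ w ∈S] * B)             ≡⟨ ∑-distribʳ-* [_∈S] B (allFin n) ⟩
    ∑ (allFin n) [_∈S] * B                       ≡⟨ cong (_* B) (trans (∣S∣≡count-∈ S) (count≡∑ _ (allFin n))) ⟨
    ∣ S ∣ * B                                    ∎
    where open ≤-Reasoning

≤-foldr-⊔ : {A : Set} (f : A → ℕ) {x : A} {xs : List A} → x ∈ xs → f x ≤ foldr _⊔_ 0 (map f xs)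
≤-foldr-⊔ f (here refl)  = m≤m⊔n _ _
≤-foldr-⊔ f (there x∈xs) = ≤-trans (≤-foldr-⊔ f x∈xs) (m≤n⊔m _ _)

module _ {a b : ℕ} where

  target : (Fin a × Fin b) × Bool → Fin (a + b)
  target ((u , _) , true)  = u ↑ˡ b
  target ((_ , v) , false) = a ↑ʳ v

  ↑ˡ≢↑ʳ : ∀ (u : Fin a) (v : Fin b) → u ↑ˡ b ≢ a ↑ʳ v
  ↑ˡ≢↑ʳ u v eq with () ← trans (sym (splitAt-↑ˡ a u b)) (trans (cong (splitAt a) eq) (splitAt-↑ʳ a b v))

  fibre≤maxInDeg : ∀ w oes → count (λ p → ⌊ target p ≟ w ⌋) oes ≤ maxInDeg oes
  fibre≤maxInDeg w oes with splitAt a w | join-splitAt a b w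
  ... | inj₁ u | refl = ≤-trans (count-mono into-u oes) (≤-trans (≤-foldr-⊔ (inDegL oes) (∈-allFin u)) (m≤m⊔n _ _))
    where
    into-u : ∀ p → T ⌊ target p ≟ u ↑ˡ b ⌋ → T (⌊ proj₁ (proj₁ p) ≟ u ⌋ ∧ proj₂ p)
    into-u ((u′ , _)  , true)  h = Equivalence.from (T-∧ {⌊ u′ ≟ u ⌋}) (fromWitness (↑ˡ-injective b u′ u (toWitness h)) , _)
    into-u ((_  , v′) , false) h = ⊥-elim (↑ˡ≢↑ʳ u v′ (sym (toWitness h)))
  ... | inj₂ v | refl = ≤-trans (count-mono into-v oes) (≤-trans (≤-foldr-⊔ (inDegR oes) (∈-allFin v)) (m≤n⊔m _ _))
    where
    into-v : ∀ p → T ⌊ target p ≟ a ↑ʳ v ⌋ → T (⌊ proj₂ (proj₁ p) ≟ v ⌋ ∧ (if proj₂ p then false else true))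
    into-v ((_  , v′) , false) h = Equivalence.from (T-∧ {⌊ v′ ≟ v ⌋}) (fromWitness (↑ʳ-injective a v′ v (toWitness h)) , _)
    into-v ((u′ , _)  , true)  h = ⊥-elim (↑ˡ≢↑ʳ u′ v (toWitness h))

length-allBools : ∀ n → All (λ o → length o ≡ n) (allBools n)
length-allBools zero    = refl ∷ []
length-allBools (suc n) = ++⁺ (map⁺ (All.map (cong suc) ih)) (++⁺ (map⁺ (All.map (cong suc) ih)) [])
  where ih = length-allBools n

replicate∈allBools : ∀ n → replicate n true ∈ allBools n
replicate∈allBools zero    = here refl
replicate∈allBools (suc n) = ∈-++⁺ˡ (∈-map⁺ (true ∷_) (replicate∈allBools n))

minL-∈ : ∀ {x xs} → x ∈ xs → minL xs ∈ xs
minL-∈ {xs = y ∷ ys} _ with foldr-selective ⊓-sel y ys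
... | inj₁ min≡y  = here min≡y
... | inj₂ min∈ys = there min∈ys

optimal-orientation : ∀ {a b} (es : List (Fin a × Fin b)) →
                      ∃[ o ] (length o ≡ length es × minMaxInDeg es ≡ maxInDeg (zip es o))
optimal-orientation es with ∈-map⁻ g (minL-∈ (∈-map⁺ g (replicate∈allBools (length es))))
  where g = λ o → maxInDeg (zip es o)
... | o , o∈allBools , min≡g[o] = o , All.lookup (length-allBools _) o∈allBools , min≡g[o]

module _ {a b : ℕ} (S : Subset (a + b)) where

  spans : Fin a × Fin b → Bool
  spans e = ⌊ (proj₁ e ↑ˡ b) ∈? S ⌋ ∧ ⌊ (a ↑ʳ proj₂ e) ∈? S ⌋

  spans≤target∈ : ∀ es o → length o ≡ length es → count spans es ≤ count (λ p → ⌊ target p ∈? S ⌋) (zip es o)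
  spans≤target∈ []       o       _  = z≤n
  spans≤target∈ (e ∷ es) (x ∷ o) eq = begin
    count spans (e ∷ es)                                        ≡⟨ count-∷ spans e es ⟩
    toℕ (spans e) + count spans es                              ≤⟨ +-mono-≤ (toℕ-mono (target∈ e x)) (spans≤target∈ es o (suc-injective eq)) ⟩
    toℕ ⌊ target (e , x) ∈? S ⌋ + count target∈S (zip es o)     ≡⟨ count-∷ target∈S (e , x) (zip es o) ⟨
    count target∈S ((e , x) ∷ zip es o)                         ∎
    where
    open ≤-Reasoning
    target∈S = λ p → ⌊ target p ∈? S ⌋
    target∈ : ∀ e x → T (spans e) → T ⌊ target (e , x) ∈? S ⌋
    target∈ e true  = proj₁ ∘ Equivalence.to T-∧
    target∈ e false = proj₂ ∘ Equivalence.to (T-∧ {⌊ (proj₁ e ↑ˡ b) ∈? S ⌋})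

  spans≤∣S∣*minMaxInDeg : ∀ es → count spans es ≤ ∣ S ∣ * minMaxInDeg es
  spans≤∣S∣*minMaxInDeg es with optimal-orientation es
  ... | o , length-o , min≡max = begin
    count spans es                                    ≤⟨ spans≤target∈ es o length-o ⟩
    count (λ p → ⌊ target p ∈? S ⌋) (zip es o)        ≤⟨ count-∈≤∣S∣* target S (zip es o) (λ w → fibre≤maxInDeg w (zip es o)) ⟩
    ∣ S ∣ * maxInDeg (zip es o)                       ≡⟨ cong (∣ S ∣ *_) min≡max ⟨
    ∣ S ∣ * minMaxInDeg es                            ∎
    where open ≤-Reasoning

nonempty⇒0<∣S∣ : ∀ {n} {S : Subset n} → Nonempty S → 0 < ∣ S ∣
nonempty⇒0<∣S∣ {S = S} (x , x∈S) = ≤-trans (≤-reflexive (sym (∣⁅x⁆∣≡1 x))) (p⊆q⇒∣p∣≤∣q∣ ⁅x⁆⊆S)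
  where
  ⁅x⁆⊆S : ⁅ x ⁆ ⊆ S
  ⁅x⁆⊆S y∈⁅x⁆ rewrite x∈⁅y⁆⇒x≡y x y∈⁅x⁆ = x∈S

-- Divided by |E|ᵀ⁺¹ this reads T·Δ_L/|E| ≤ 4·OPT.
expected-degree≤4opt : ∀ G → ΔL≤4ρ* G → ∀ T → T * sampleSize G T * ΔL G ≤ 4 * nE G * optNum G T
expected-degree≤4opt G (S , nonempty , Δ∣S∣≤4e) T = *-cancelˡ-≤ ∣ S ∣ (begin
  ∣ S ∣ * (T * M * ΔL G)             ≡⟨ x*[y*z]≡y*[z*x] ∣ S ∣ (T * M) (ΔL G) ⟩
  T * M * (ΔL G * ∣ S ∣)             ≤⟨ *-monoʳ-≤ (T * M) Δ∣S∣≤4e ⟩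
  T * M * (4 * d)                    ≡⟨ cong (λ M → T * M * (4 * d)) (length-allSeqs T m) ⟩
  T * m ^ T * (4 * d)                ≡⟨ x*y*[4*z]≡4*[x*z*y] T (m ^ T) d ⟩
  4 * (T * d * m ^ T)                ≡⟨ cong (4 *_) (∑-hits T) ⟨
  4 * (m * ∑ Ls hits)                ≤⟨ *-monoʳ-≤ 4 (*-monoʳ-≤ m ∑hits≤∣S∣*opt) ⟩
  4 * (m * (∣ S ∣ * optNum G T))     ≡⟨ 4*[x*[y*z]]≡y*[4*x*z] m ∣ S ∣ (optNum G T) ⟩
  ∣ S ∣ * (4 * m * optNum G T)       ∎)
  where
  open Draws (edges G) (spans S)
  open ≤-Reasoning
  instance _ = >-nonZero (nonempty⇒0<∣S∣ nonempty)
  M = sampleSize G T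
  Ls = allSeqs T m
  ∑hits≤∣S∣*opt : ∑ Ls hits ≤ ∣ S ∣ * optNum G T
  ∑hits≤∣S∣*opt = ≤-trans (∑-mono-≤ (λ s → spans≤∣S∣*minMaxInDeg S (sampled G s)) Ls)
                          (≤-reflexive (∑-distribˡ-* ∣ S ∣ _ Ls))
  x*[y*z]≡y*[z*x] : ∀ x y z → x * (y * z) ≡ y * (z * x)
  x*[y*z]≡y*[z*x] = solve-∀
  x*y*[4*z]≡4*[x*z*y] : ∀ x y z → x * y * (4 * z) ≡ 4 * (x * z * y)
  x*y*[4*z]≡4*[x*z*y] = solve-∀
  4*[x*[y*z]]≡y*[4*x*z] : ∀ x y z → 4 * (x * (y * z)) ≡ y * (4 * x * z)
  4*[x*[y*z]]≡y*[4*x*z] = solve-∀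

m<[1+m/n]*n : ∀ m n .{{_ : NonZero n}} → m < suc (m / n) * n
m<[1+m/n]*n m n = begin-strict
  m                    ≡⟨ m≡m%n+[m/n]*n m n ⟩
  m % n + m / n * n    <⟨ +-monoˡ-< (m / n * n) (m%n<n m n) ⟩
  suc (m / n) * n      ∎
  where open ≤-Reasoning

-- K = 64 + c: the 64 = 4 · 16 absorbs the constants of expected-degree≤4opt and atLeast-tail,
-- and c + 1 ≤ K turns the tail 2⁻ᵏ into n^-(c+1).
module _ (c : ℕ) (G : BipGraph) (ρ : ΔL≤4ρ* G) (T : ℕ) .{{_ : NonZero (sampleSize G T)}} where

  private
    K = 64 + c
    n = nV G
    m = nE G
    M = sampleSize G T
    Ls = allSeqs T m
    X = K * (optNum G T + M * ⌈log₂ n ⌉)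
    k = suc (X / M)

    overloaded : Fin (a G) → Vec (Fin m) T → Bool
    overloaded u s = ⌊ X <? degL (sampled G s) u * M ⌋

  overloaded⇒k≤deg : ∀ u s → Bool.T (overloaded u s) → k ≤ degL (sampled G s) u
  overloaded⇒k≤deg u s X<deg*M = m<n*o⇒m/o<n {X} {degL (sampled G s) u} (toWitness X<deg*M)

  K*log₂n<k : K * ⌈log₂ n ⌉ < k
  K*log₂n<k = *-cancelʳ-< M (K * ⌈log₂ n ⌉) k (begin-strict
    K * ⌈log₂ n ⌉ * M      ≡⟨ x*y*z≡x*[z*y] K ⌈log₂ n ⌉ M ⟩
    K * (M * ⌈log₂ n ⌉)    ≤⟨ *-monoʳ-≤ K (m≤n+m _ (optNum G T)) ⟩
    X                      <⟨ m<[1+m/n]*n X M ⟩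
    k * M                  ∎)
    where open ≤-Reasoning
          x*y*z≡x*[z*y] : ∀ x y z → x * y * z ≡ x * (z * y)
          x*y*z≡x*[z*y] = solve-∀

  n^[1+c]≤2^k : n ^ suc c ≤ 2 ^ k
  n^[1+c]≤2^k = begin
    n ^ suc c                  ≤⟨ ^-monoˡ-≤ (suc c) (n≤2^⌈log₂n⌉ n) ⟩
    (2 ^ ⌈log₂ n ⌉) ^ suc c    ≡⟨ ^-*-assoc 2 ⌈log₂ n ⌉ (suc c) ⟩
    2 ^ (⌈log₂ n ⌉ * suc c)    ≤⟨ ^-monoʳ-≤ 2 (*-monoʳ-≤ ⌈log₂ n ⌉ (m≤n+m (suc c) 63)) ⟩
    2 ^ (⌈log₂ n ⌉ * K)        ≤⟨ ^-monoʳ-≤ 2 (≤-trans (≤-reflexive (*-comm ⌈log₂ n ⌉ K)) (<⇒≤ K*log₂n<k)) ⟩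
    2 ^ k                      ∎
    where open ≤-Reasoning

  16*T*deg≤k*m : ∀ u → 16 * (T * degL (edges G) u) ≤ k * m
  16*T*deg≤k*m u = *-cancelʳ-≤ _ _ (4 * M) {{m*n≢0 4 M}} (begin
    16 * (T * d) * (4 * M)     ≡⟨ 16*[x*y]*[4*z]≡64*[x*z*y] T d M ⟩
    64 * (T * M * d)           ≤⟨ *-mono-≤ (m≤m+n 64 c) (*-monoʳ-≤ (T * M) d≤ΔL) ⟩
    K * (T * M * ΔL G)         ≤⟨ *-monoʳ-≤ K (expected-degree≤4opt G ρ T) ⟩
    K * (4 * m * optNum G T)   ≡⟨ x*[y*z]≡y*[x*z] K (4 * m) (optNum G T) ⟩
    4 * m * (K * optNum G T)   ≤⟨ *-monoʳ-≤ (4 * m) (*-monoʳ-≤ K (m≤m+n (optNum G T) _)) ⟩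
    4 * m * X                  ≤⟨ *-monoʳ-≤ (4 * m) (<⇒≤ (m<[1+m/n]*n X M)) ⟩
    4 * m * (k * M)            ≡⟨ 4*x*[y*z]≡y*x*[4*z] m k M ⟩
    k * m * (4 * M)            ∎)
    where
    open ≤-Reasoning
    d = degL (edges G) u
    d≤ΔL : d ≤ ΔL G
    d≤ΔL = ≤-foldr-⊔ (degL (edges G)) (∈-allFin u)
    16*[x*y]*[4*z]≡64*[x*z*y] : ∀ x y z → 16 * (x * y) * (4 * z) ≡ 64 * (x * z * y)
    16*[x*y]*[4*z]≡64*[x*z*y] = solve-∀
    x*[y*z]≡y*[x*z] : ∀ x y z → x * (y * z) ≡ y * (x * z)
    x*[y*z]≡y*[x*z] = solve-∀
    4*x*[y*z]≡y*x*[4*z] : ∀ x y z → 4 * x * (y * z) ≡ y * x * (4 * z)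
    4*x*[y*z]≡y*x*[4*z] = solve-∀

  overloaded-tail : ∀ u → count (overloaded u) Ls * n ^ suc c ≤ M
  overloaded-tail u = begin
    count (overloaded u) Ls * n ^ suc c  ≤⟨ *-mono-≤ (count-mono (λ s → ≤⇒≤ᵇ ∘ overloaded⇒k≤deg u s) Ls) n^[1+c]≤2^k ⟩
    atLeast T k * 2 ^ k                  ≤⟨ atLeast-tail T k (16*T*deg≤k*m u) ⟩
    m ^ T                                ≡⟨ length-allSeqs T m ⟨
    M                                    ∎
    where open Draws (edges G) (λ e → ⌊ proj₁ e ≟ u ⌋) using (atLeast; atLeast-tail)
          open ≤-Reasoning

  badCount*n^[1+c]≤n*M : badCount G T K * n ^ suc c ≤ n * M
  badCount*n^[1+c]≤n*M = begin
    badCount G T K * n ^ suc c                                   ≤⟨ *-monoˡ-≤ (n ^ suc c) (count-⋁ overloaded (allFin (a G)) Ls) ⟩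
    ∑ (allFin (a G)) (λ u → count (overloaded u) Ls) * n ^ suc c ≡⟨ ∑-distribʳ-* _ (n ^ suc c) (allFin (a G)) ⟨
    ∑ (allFin (a G)) (λ u → count (overloaded u) Ls * n ^ suc c) ≤⟨ ∑-mono-≤ overloaded-tail (allFin (a G)) ⟩
    ∑ (allFin (a G)) (λ _ → M)                                   ≡⟨ ∑-const M (allFin (a G)) ⟩
    length (allFin (a G)) * M                                    ≡⟨ cong (_* M) (length-allFin (a G)) ⟩
    a G * M                                                      ≤⟨ *-monoˡ-≤ M (m≤m+n (a G) (b G)) ⟩
    n * M                                                        ∎
    where open ≤-Reasoning

m≤o⇒m*n^[1+c]≤n*o⇒m*n^c≤o : ∀ {m o} n c → m ≤ o → m * n ^ suc c ≤ n * o → m * n ^ c ≤ o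
m≤o⇒m*n^[1+c]≤n*o⇒m*n^c≤o {m} zero    zero    m≤o _  = ≤-trans (≤-reflexive (*-identityʳ m)) m≤o
m≤o⇒m*n^[1+c]≤n*o⇒m*n^c≤o {m} zero    (suc c) _   _  = ≤-trans (≤-reflexive (*-zeroʳ m)) z≤n
m≤o⇒m*n^[1+c]≤n*o⇒m*n^c≤o {m} (suc n) c       _   le =
  *-cancelˡ-≤ (suc n) (≤-trans (≤-reflexive (x*[y*z]≡y*[x*z] (suc n) m _)) le)
  where x*[y*z]≡y*[x*z] : ∀ x y z → x * (y * z) ≡ y * (x * z)
        x*[y*z]≡y*[x*z] = solve-∀

claim4p6 : (c : ℕ) → ∃[ C ] ((G : BipGraph) → Simple G → ΔL≤4ρ* G →
             (T : ℕ) → badCount G T C * nV G ^ c ≤ sampleSize G T)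
claim4p6 c = 64 + c , λ G _ ρ T →
  let bad≤M = count≤length (Bad G T (64 + c)) (allSeqs T (nE G)) in
  case sampleSize G T ℕ.≟ 0 of λ where
    (yes M≡0) → ≤-trans (≤-reflexive (cong (_* nV G ^ c) (n≤0⇒n≡0 (≤-trans bad≤M (≤-reflexive M≡0))))) z≤n
    (no  M≢0) → m≤o⇒m*n^[1+c]≤n*o⇒m*n^c≤o (nV G) c bad≤M (badCount*n^[1+c]≤n*M c G ρ T {{≢-nonZero M≢0}})
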